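{- Let $k,s\ge 1$ and $R_{k,s}=\mathbb{F}_{4^{2k}}[u_1,\dots,u_s]/\langle u_1^2-u_1,\dots,u_s^2-u_s\rangle$, with automorphism $\theta$ given by $\theta(a)=a^{4^k}$ for $a\in\mathbb{F}_{4^{2k}}$ and $\theta(u_i)=u_i+1$. Let $T_0,\dots,T_{2^s-1}$, $U_j$, $I_i$ and the Gray map $\varphi:R_{k,s}\to\mathbb{F}_{4^{2k}}^{2^s}$ be as in the context. Let $\alpha=b_0U_0+b_1U_1+\cdots+b_{2^s-1}U_{2^s-1}\in R_{k,s}$ with $b_j\in\mathbb{F}_{4^{2k}}$. Then $\varphi(\alpha)=(\alpha_0,\alpha_1,\dots,\alpha_{2^s-1})$ where, for each $i$, $$\alpha_i=\sum_{\substack{0\le j\le 2^s-1\\ T_i\cdot T_j=(0,\dots,0)}} b_j,$$ and $T_i\cdot T_j$ denotes the componentwise product of the two vectors.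
   Context: $T_0,\dots,T_{2^s-1}$ is the list of all of $\{0,1\}^s$ ordered first by increasing number of ones and, among tuples with the same number of ones, in decreasing lexicographic order (so $T_0=(0,\dots,0)$, $T_1=(1,0,\dots,0)$, …, $T_{2^s-1}=(1,\dots,1)$). For $T_j=(e_1,\dots,e_s)$ set $U_j=u_1^{e_1}\cdots u_s^{e_s}$. For $T_i=(r_1,\dots,r_s)$ set $I_i=\theta^{r_1}(u_1)\cdots\theta^{r_s}(u_s)$ (with $\theta^0(u_j)=u_j$, $\theta^1(u_j)=u_j+1$). The $I_i$ are orthogonal idempotents summing to $1$ and every $\alpha\in R_{k,s}$ can be written uniquely as $\alpha=\alpha_0I_0+\cdots+\alpha_{2^s-1}I_{2^s-1}$ with $\alpha_i\in\mathbb{F}_{4^{2k}}$; the Gray map is $\varphi(\alpha)=(\alpha_0,\dots,\alpha_{2^s-1})$. -}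

module Defs where

open import Level using (Level; _⊔_; suc)
open import Algebra.Bundles using (CommutativeRing)
open import Data.Bool using (Bool; true; false; _∨_; _∧_; if_then_else_)
open import Data.Nat as ℕ using (ℕ; zero; _^_)
open import Data.Fin using (Fin; _≟_)
open import Relation.Nullary.Decidable using (⌊_⌋)
open import Data.Vec using (Vec; []; _∷_; lookup; replicate; zipWith; allFin; tabulate)
open import Data.List as List using (List; []; _∷_; _++_; map; concatMap; upTo; length)
open import Data.Product using (Σ; ∃; _×_; _,_)
open import Relation.Nullary using (¬_)
open import Relation.Binary.PropositionalEquality using (_≡_)

record Field (c ℓ : Level) : Set (Level.suc (c ⊔ ℓ)) where
  field
    commutativeRing : CommutativeRing c ℓ
  open CommutativeRing commutativeRing public
  field
    0≉1     : ¬ (0# ≈ 1#)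
    inverse : ∀ x → ¬ (x ≈ 0#) → Σ Carrier (λ y → (x * y) ≈ 1#)

record HasCardinality {c ℓ} (F : Field c ℓ) (n : ℕ) : Set (c ⊔ ℓ) where
  open Field F
  field
    enum       : Fin n → Carrier
    enum-inj   : ∀ i j → enum i ≈ enum j → i ≡ j
    enum-surj  : ∀ x → Σ (Fin n) (λ i → enum i ≈ x)

-- The tuples T_0, …, T_{2^s - 1}:
-- ordered by increasing number of ones, and among tuples with the same
-- number of ones in decreasing lexicographic order.

withOnes : (n w : ℕ) → List (Vec Bool n)
withOnes zero    zero    = [] ∷ []
withOnes zero    (ℕ.suc w) = []
withOnes (ℕ.suc n) zero    = map (false ∷_) (withOnes n zero)
withOnes (ℕ.suc n) (ℕ.suc w) =
  map (true ∷_) (withOnes n w) ++ map (false ∷_) (withOnes n (ℕ.suc w))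

Tlist : (s : ℕ) → List (Vec Bool s)
Tlist s = concatMap (withOnes s) (upTo (ℕ.suc s))

-- number of tuples (equal to 2^s)
N : ℕ → ℕ
N s = length (Tlist s)

T : (s : ℕ) → Fin (N s) → Vec Bool s
T s i = List.lookup (Tlist s) i

_·_ : ∀ {s} → Vec Bool s → Vec Bool s → Vec Bool s
_·_ = zipWith _∧_

isZero : ∀ {s} → Vec Bool s → Bool
isZero [] = true
isZero (true ∷ v) = false
isZero (false ∷ v) = isZero v

eqB : Bool → Bool → Bool
eqB true true = true
eqB false false = true
eqB _ _ = false

eqVec : ∀ {n} → Vec Bool n → Vec Bool n → Bool
eqVec [] [] = true
eqVec (x ∷ xs) (y ∷ ys) = eqB x y ∧ eqVec xs ys

unitVec : ∀ {s} → Fin s → Vec Bool s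
unitVec {s} j = tabulate (λ i → ⌊ i ≟ j ⌋)

allTuples : (s : ℕ) → List (Vec Bool s)
allTuples zero = [] ∷ []
allTuples (ℕ.suc s) = map (true ∷_) (allTuples s) ++ map (false ∷_) (allTuples s)

-- The ring R = F[u_1,…,u_s]/⟨u_1²-u_1,…,u_s²-u_s⟩, represented in its
-- standard basis of multilinear monomials u^e (e ∈ {0,1}^s):
-- an element is its coefficient function e ↦ coefficient of u^e.
-- Since u_i² = u_i, u^a · u^b = u^(a ∨ b).

module QuotientRing {c ℓ} (F : Field c ℓ) (s : ℕ) where
  open Field F

  R : Set c
  R = Vec Bool s → Carrier

  infix 4 _≈R_
  _≈R_ : R → R → Set ℓ
  p ≈R q = ∀ e → p e ≈ q e

  sumF : List Carrier → Carrier
  sumF = List.foldr _+_ 0#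

  infixl 6 _+R_
  infixl 7 _*R_

  _+R_ : R → R → R
  (p +R q) e = p e + q e

  0R : R
  0R e = 0#

  ι : Carrier → R
  ι a e = if isZero e then a else 0#

  1R : R
  1R = ι 1#

  _*R_ : R → R → R
  (p *R q) e = sumF (concatMap (λ a → map (λ b →
                 if eqVec (zipWith _∨_ a b) e then p a * q b else 0#)
                 (allTuples s)) (allTuples s))

  sumR : ∀ {n} → (Fin n → R) → R
  sumR {n} f = List.foldr _+R_ 0R (map f (List.allFin n))

  prodR : ∀ {n} → (Fin n → R) → R
  prodR {n} f = List.foldr _*R_ 1R (map f (List.allFin n))

  u : Fin s → R
  u j e = if eqVec e (unitVec j) then 1# else 0#

  θpow : Bool → Fin s → R
  θpow false j = u j
  θpow true  j = u j +R 1R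

  Umon : Vec Bool s → R
  Umon e = prodR (λ j → if lookup e j then u j else 1R)

  Iidem : Vec Bool s → R
  Iidem r = prodR (λ j → θpow (lookup r j) j)

  U : Fin (N s) → R
  U j = Umon (T s j)

  I : Fin (N s) → R
  I i = Iidem (T s i)

  combI : (Fin (N s) → Carrier) → R
  combI c = sumR (λ i → ι (c i) *R I i)

  combU : (Fin (N s) → Carrier) → R
  combU b = sumR (λ j → ι (b j) *R U j)

  grayFormula : (Fin (N s) → Carrier) → Fin (N s) → Carrier
  grayFormula b i =
    sumF (map (λ j → if isZero (T s i · T s j) then b j else 0#) (List.allFin (N s)))

  -- "a is a representation of α in the idempotent basis":
  -- α = a_0 I_0 + ⋯ + a_{2^s-1} I_{2^s-1}.  By uniqueness, φ(α) = a.
  IdemCoeffs : R → (Fin (N s) → Carrier) → Set ℓ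
  IdemCoeffs α a = combI a ≈R α

module Submission where

-- For p in R = F[u_1,…,u_s]/⟨u_i² - u_i⟩ and x ∈ {0,1}^s, the value eval x p
-- is the sum of the coefficients of the monomials u^e with e ≼ x.  Evaluation
-- is a ring homomorphism R → F (u^a u^b = u^(a ∨ b), and a ∨ b ≼ x iff a ≼ x
-- and b ≼ x), and in characteristic 2 Möbius inversion on the Boolean lattice
-- recovers p from its 2^s values.  On the two bases eval x U_e = [e ≼ x] and,
-- as θ(u_j) = u_j + 1 takes the value x_j + 1 = [x_j = 0], eval x I_r = [x = ∁r].
-- Existence: evaluating Σ_i g_i I_i and Σ_j b_j U_j, with g the claimed Gray
-- image, at every x reduces to Σ_i [T_i·t = 0] [x = ∁T_i] = [t ≼ x].
-- Uniqueness: evaluating any representation Σ_i a_i I_i at x = ∁T_i returns a_i.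
-- Both steps use that T_0,…,T_{2^s-1} lists every tuple exactly once, and
-- characteristic 2 follows from |F| = 4^(2k) = 2^(4k).

open import Defs
open import Algebra.Bundles using (CommutativeMonoid; CommutativeRing)
open import Data.Bool using (Bool; true; false; not; _∧_; _∨_; if_then_else_)
open import Data.Bool.Properties using (∧-zeroʳ)
open import Data.Nat as ℕ using (ℕ; zero; suc; _<_; s≤s; _≥_; _^_)
import Data.Nat.Properties as ℕₚ
open import Data.Fin as Fin using (Fin; _≟_)
open import Data.Fin.Permutation using (permutation)
open import Data.Vec as Vec using (Vec; []; _∷_; lookup; zipWith; tabulate)
open import Data.List as List using (List; []; _∷_; _++_; map; concatMap; foldr; upTo; allFin)
import Data.List.Properties as Listₚ
import Data.Vec.Properties as Vecₚ
open import Data.List.Membership.Propositional using (_∈_)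
open import Data.List.Membership.Propositional.Properties using (∈-allFin)
open import Data.List.Relation.Unary.Any using (here; there)
open import Data.Product using (_×_; _,_; proj₁; proj₂)
open import Data.Empty using (⊥; ⊥-elim)
open import Relation.Nullary using (¬_; yes; no)
open import Relation.Nullary.Decidable using (⌊_⌋)
open import Relation.Binary.PropositionalEquality as P using (_≡_)
open import Function using (_∘_)

_≤ᵇ_ : Bool → Bool → Bool
true ≤ᵇ false = false
_    ≤ᵇ _     = true

infix 4 _≼_
_≼_ : ∀ {n} → Vec Bool n → Vec Bool n → Bool
[]       ≼ []       = true
(a ∷ as) ≼ (b ∷ bs) = (a ≤ᵇ b) ∧ (as ≼ bs)

∁ : ∀ {n} → Vec Bool n → Vec Bool n
∁ = Vec.map not

∁-involutive : ∀ {n} (x : Vec Bool n) → ∁ (∁ x) ≡ x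
∁-involutive []          = P.refl
∁-involutive (true ∷ x)  = P.cong (true ∷_) (∁-involutive x)
∁-involutive (false ∷ x) = P.cong (false ∷_) (∁-involutive x)

-- A join lies below x iff both parts do; this makes evaluation multiplicative.
∨-≼ : ∀ {n} (a b x : Vec Bool n) → (zipWith _∨_ a b ≼ x) ≡ (a ≼ x) ∧ (b ≼ x)
∨-≼ [] [] [] = P.refl
∨-≼ (true ∷ a) (b₀ ∷ b) (true ∷ x) with b₀
... | true  = ∨-≼ a b x
... | false = ∨-≼ a b x
∨-≼ (true ∷ a)  (b₀ ∷ b)    (false ∷ x) = P.refl
∨-≼ (false ∷ a) (true ∷ b)  (true ∷ x)  = ∨-≼ a b x
∨-≼ (false ∷ a) (true ∷ b)  (false ∷ x) = P.sym (∧-zeroʳ _)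
∨-≼ (false ∷ a) (false ∷ b) (x₀ ∷ x) with x₀
... | true  = ∨-≼ a b x
... | false = ∨-≼ a b x

zero-≼ : ∀ {n} (x : Vec Bool n) → (tabulate {n = n} (λ _ → false) ≼ x) ≡ true
zero-≼ []       = P.refl
zero-≼ (_ ∷ x)  = zero-≼ x

unitVec-suc : ∀ {n} (j : Fin n) → tabulate (λ i → ⌊ Fin.suc i ≟ Fin.suc j ⌋) ≡ unitVec j
unitVec-suc j = Vecₚ.tabulate-cong suc≟suc
  where
  suc≟suc : ∀ i → ⌊ Fin.suc i ≟ Fin.suc j ⌋ ≡ ⌊ i ≟ j ⌋
  suc≟suc i with i ≟ j
  ... | yes _ = P.refl
  ... | no _  = P.refl

unitVec-≼ : ∀ {n} (j : Fin n) (x : Vec Bool n) → (unitVec j ≼ x) ≡ lookup x j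
unitVec-≼ Fin.zero    (true ∷ x)  = zero-≼ x
unitVec-≼ Fin.zero    (false ∷ x) = P.refl
unitVec-≼ (Fin.suc j) (x₀ ∷ x)    =
  P.trans (P.cong (λ v → (false ≤ᵇ x₀) ∧ (v ≼ x)) (unitVec-suc j)) (unitVec-≼ j x)

isZero-eqVec : ∀ {n} (e : Vec Bool n) → isZero e ≡ eqVec (tabulate (λ _ → false)) e
isZero-eqVec []          = P.refl
isZero-eqVec (true ∷ e)  = P.refl
isZero-eqVec (false ∷ e) = isZero-eqVec e

isZero-·-≼∁ : ∀ {n} (a b : Vec Bool n) → isZero (a · b) ≡ (b ≼ ∁ a)
isZero-·-≼∁ []          []          = P.refl
isZero-·-≼∁ (true ∷ a)  (true ∷ b)  = P.refl
isZero-·-≼∁ (true ∷ a)  (false ∷ b) = isZero-·-≼∁ a b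
isZero-·-≼∁ (false ∷ a) (true ∷ b)  = isZero-·-≼∁ a b
isZero-·-≼∁ (false ∷ a) (false ∷ b) = isZero-·-≼∁ a b

eqVec-sound : ∀ {n} (a b : Vec Bool n) → eqVec a b ≡ true → a ≡ b
eqVec-sound []          []          _  = P.refl
eqVec-sound (true ∷ a)  (true ∷ b)  eq = P.cong (true ∷_) (eqVec-sound a b eq)
eqVec-sound (false ∷ a) (false ∷ b) eq = P.cong (false ∷_) (eqVec-sound a b eq)
eqVec-sound (true ∷ a)  (false ∷ b) ()
eqVec-sound (false ∷ a) (true ∷ b)  ()

eqVec-refl : ∀ {n} (a : Vec Bool n) → eqVec a a ≡ true
eqVec-refl []          = P.refl
eqVec-refl (true ∷ a)  = eqVec-refl a
eqVec-refl (false ∷ a) = eqVec-refl a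

eqVec-sym : ∀ {n} (a b : Vec Bool n) → eqVec a b ≡ eqVec b a
eqVec-sym []          []          = P.refl
eqVec-sym (true ∷ a)  (true ∷ b)  = eqVec-sym a b
eqVec-sym (true ∷ a)  (false ∷ b) = P.refl
eqVec-sym (false ∷ a) (true ∷ b)  = P.refl
eqVec-sym (false ∷ a) (false ∷ b) = eqVec-sym a b

eqVec-∁ʳ : ∀ {n} (x v : Vec Bool n) → eqVec x (∁ v) ≡ eqVec (∁ x) v
eqVec-∁ʳ []          []          = P.refl
eqVec-∁ʳ (true ∷ x)  (true ∷ v)  = P.refl
eqVec-∁ʳ (true ∷ x)  (false ∷ v) = eqVec-∁ʳ x v
eqVec-∁ʳ (false ∷ x) (true ∷ v)  = eqVec-∁ʳ x v
eqVec-∁ʳ (false ∷ x) (false ∷ v) = P.refl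

eqVec-∁∁ : ∀ {n} (a b : Vec Bool n) → eqVec (∁ a) (∁ b) ≡ eqVec a b
eqVec-∁∁ a b = P.trans (P.sym (eqVec-∁ʳ a (∁ b))) (P.cong (eqVec a) (∁-involutive b))

count : ∀ {a} {A : Set a} → List A → (A → Bool) → ℕ
count L Q = foldr ℕ._+_ 0 (map (λ x → if Q x then 1 else 0) L)

module ListSum {c ℓ} (M : CommutativeMonoid c ℓ) where
  open CommutativeMonoid M
  open import Algebra.Properties.CommutativeSemigroup commutativeSemigroup
    using (interchange)

  Σ : ∀ {a} {A : Set a} → List A → (A → Carrier) → Carrier
  Σ L f = foldr _∙_ ε (map f L)

  when : Bool → Carrier → Carrier
  when b y = if b then y else ε

  when-ε : ∀ b → when b ε ≡ ε
  when-ε true  = P.refl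
  when-ε false = P.refl

  when-cong : ∀ b {x y} → x ≈ y → when b x ≈ when b y
  when-cong true  x≈y = x≈y
  when-cong false _   = refl

  when-when : ∀ a b y → when a (when b y) ≡ when (b ∧ a) y
  when-when true  true  y = P.refl
  when-when true  false y = P.refl
  when-when false true  y = P.refl
  when-when false false y = P.refl

  module _ {a} {A : Set a} where
    Σ-cong : ∀ (L : List A) {f g : A → Carrier} → (∀ x → f x ≈ g x) → Σ L f ≈ Σ L g
    Σ-cong []      f≈g = refl
    Σ-cong (x ∷ L) f≈g = ∙-cong (f≈g x) (Σ-cong L f≈g)

    Σ-++ : ∀ (L K : List A) f → Σ (L ++ K) f ≈ Σ L f ∙ Σ K f
    Σ-++ []      K f = sym (identityˡ _)
    Σ-++ (x ∷ L) K f = trans (∙-congˡ (Σ-++ L K f)) (sym (assoc _ _ _))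

    Σ-ε : ∀ (L : List A) → Σ L (λ _ → ε) ≈ ε
    Σ-ε []      = refl
    Σ-ε (x ∷ L) = trans (identityˡ _) (Σ-ε L)

    Σ-zero : ∀ (L : List A) f → (∀ x → f x ≈ ε) → Σ L f ≈ ε
    Σ-zero L f f≈ε = trans (Σ-cong L f≈ε) (Σ-ε L)

    Σ-∙ : ∀ (L : List A) f g → Σ L (λ x → f x ∙ g x) ≈ Σ L f ∙ Σ L g
    Σ-∙ []      f g = sym (identityˡ _)
    Σ-∙ (x ∷ L) f g = trans (∙-congˡ (Σ-∙ L f g)) (interchange _ _ _ _)

    Σ-when : ∀ b (L : List A) f → when b (Σ L f) ≈ Σ L (λ x → when b (f x))
    Σ-when true  L f = refl
    Σ-when false L f = sym (Σ-ε L)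

  Σ-map : ∀ {a b} {A : Set a} {B : Set b} (g : A → B) (L : List A) f →
          Σ (map g L) f ≡ Σ L (f ∘ g)
  Σ-map g []      f = P.refl
  Σ-map g (x ∷ L) f = P.cong (f (g x) ∙_) (Σ-map g L f)

  Σ-concatMap : ∀ {a b} {A : Set a} {B : Set b} (g : A → List B) (L : List A) f →
                Σ (concatMap g L) f ≈ Σ L (λ x → Σ (g x) f)
  Σ-concatMap g []      f = refl
  Σ-concatMap g (x ∷ L) f = trans (Σ-++ (g x) (concatMap g L) f) (∙-congˡ (Σ-concatMap g L f))

  Σ-swap : ∀ {a b} {A : Set a} {B : Set b} (L : List A) (K : List B) (f : A → B → Carrier) →
           Σ L (λ x → Σ K (f x)) ≈ Σ K (λ y → Σ L (λ x → f x y))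
  Σ-swap []      K f = sym (Σ-ε K)
  Σ-swap (x ∷ L) K f = trans (∙-congˡ (Σ-swap L K f)) (sym (Σ-∙ K (f x) _))

  Σ-allFin-suc : ∀ {n} (g : Fin (suc n) → Carrier) →
                 Σ (allFin (suc n)) g ≡ g Fin.zero ∙ Σ (allFin n) (g ∘ Fin.suc)
  Σ-allFin-suc g = P.cong (g Fin.zero ∙_) (P.trans
    (P.cong (foldr _∙_ ε) (Listₚ.map-tabulate Fin.suc g))
    (P.sym (P.cong (foldr _∙_ ε) (Listₚ.map-tabulate (λ i → i) (g ∘ Fin.suc)))))

  Σ-allFin-lookup : ∀ {a} {A : Set a} (L : List A) h →
                    Σ (allFin (List.length L)) (h ∘ List.lookup L) ≡ Σ L h
  Σ-allFin-lookup []      h = P.refl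
  Σ-allFin-lookup (x ∷ L) h =
    P.trans (Σ-allFin-suc (h ∘ List.lookup (x ∷ L))) (P.cong (h x ∙_) (Σ-allFin-lookup L h))

  Σ-upTo-suc : ∀ m (G : ℕ → Carrier) → Σ (upTo (suc m)) G ≡ G 0 ∙ Σ (upTo m) (G ∘ suc)
  Σ-upTo-suc m G = P.cong (G 0 ∙_) (P.trans
    (P.cong (foldr _∙_ ε) (Listₚ.map-applyUpTo suc G m))
    (P.sym (P.cong (foldr _∙_ ε) (Listₚ.map-applyUpTo (λ k → k) (G ∘ suc) m))))

  module _ {a} {A : Set a} (Q : A → Bool) (f : A → Carrier) where
    Σ-when-none : ∀ L → count L Q ≡ 0 → Σ L (λ y → when (Q y) (f y)) ≈ ε
    Σ-when-none []      _ = refl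
    Σ-when-none (y ∷ L) c≡0 with Q y
    ... | false = trans (identityˡ _) (Σ-when-none L c≡0)
    ... | true with c≡0
    ... | ()

    count-pos : ∀ L {x} → x ∈ L → Q x ≡ true → count L Q ≡ 0 → ⊥
    count-pos (y ∷ L) (here P.refl) Qx c≡0 rewrite Qx with c≡0
    ... | ()
    count-pos (y ∷ L) (there x∈L) Qx c≡0 with Q y
    ... | true with c≡0
    ... | ()
    count-pos (y ∷ L) (there x∈L) Qx c≡0 | false = count-pos L x∈L Qx c≡0

    Σ-when-unique : ∀ L {x} → x ∈ L → Q x ≡ true → count L Q ≡ 1 →
                    Σ L (λ y → when (Q y) (f y)) ≈ f x
    Σ-when-unique (y ∷ L) (here P.refl) Qx c≡1 rewrite Qx =
      trans (∙-congˡ (Σ-when-none L (ℕₚ.suc-injective c≡1))) (identityʳ _)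
    Σ-when-unique (y ∷ L) (there x∈L) Qx c≡1 with Q y
    ... | true  = ⊥-elim (count-pos L x∈L Qx (ℕₚ.suc-injective c≡1))
    ... | false = trans (identityˡ _) (Σ-when-unique L x∈L Qx c≡1)

module CubeSum {c ℓ} (M : CommutativeMonoid c ℓ) where
  open CommutativeMonoid M
  open ListSum M
  open import Algebra.Properties.CommutativeSemigroup commutativeSemigroup
    using (x∙yz≈y∙xz)
  open import Relation.Binary.Reasoning.Setoid setoid

  Σ-1∷-++-0∷ : ∀ {n} (K L : List (Vec Bool n)) (f : Vec Bool (suc n) → Carrier) →
               Σ (map (true ∷_) K ++ map (false ∷_) L) f ≈ Σ K (f ∘ (true ∷_)) ∙ Σ L (f ∘ (false ∷_))
  Σ-1∷-++-0∷ K L f = trans (Σ-++ (map (true ∷_) K) _ f)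
    (reflexive (P.cong₂ _∙_ (Σ-map (true ∷_) K f) (Σ-map (false ∷_) L f)))

  Σ-cube-suc : ∀ n (f : Vec Bool (suc n) → Carrier) → Σ (allTuples (suc n)) f ≈
               Σ (allTuples n) (f ∘ (true ∷_)) ∙ Σ (allTuples n) (f ∘ (false ∷_))
  Σ-cube-suc n = Σ-1∷-++-0∷ (allTuples n) (allTuples n)

  Σ-cube-δ : ∀ n (c : Vec Bool n) (h : Vec Bool n → Carrier) →
             Σ (allTuples n) (λ e → when (eqVec c e) (h e)) ≈ h c
  Σ-cube-δ zero    []          h = identityʳ _
  Σ-cube-δ (suc n) (true ∷ c)  h = begin
    _                  ≈⟨ Σ-cube-suc n _ ⟩
    _                  ≈⟨ ∙-cong (Σ-cube-δ n c (h ∘ (true ∷_))) (Σ-ε (allTuples n)) ⟩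
    h (true ∷ c) ∙ ε   ≈⟨ identityʳ _ ⟩
    h (true ∷ c)       ∎
  Σ-cube-δ (suc n) (false ∷ c) h = begin
    _                  ≈⟨ Σ-cube-suc n _ ⟩
    _                  ≈⟨ ∙-cong (Σ-ε (allTuples n)) (Σ-cube-δ n c (h ∘ (false ∷_))) ⟩
    ε ∙ h (false ∷ c)  ≈⟨ identityˡ _ ⟩
    h (false ∷ c)      ∎

  Σ-byWeight : ∀ n m → n < m → (h : Vec Bool n → Carrier) →
               Σ (upTo m) (λ w → Σ (withOnes n w) h) ≈ Σ (allTuples n) h
  Σ-byWeight zero    (suc m) _ h = begin
    Σ (upTo (suc m)) (λ w → Σ (withOnes 0 w) h)  ≡⟨ Σ-upTo-suc m _ ⟩
    (h [] ∙ ε) ∙ Σ (upTo m) (λ _ → ε)            ≈⟨ ∙-congˡ (Σ-ε (upTo m)) ⟩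
    (h [] ∙ ε) ∙ ε                               ≈⟨ identityʳ _ ⟩
    Σ (allTuples 0) h                            ∎
  Σ-byWeight (suc n) (suc m) (s≤s n<m) h = begin
    Σ (upTo (suc m)) (λ w → Σ (withOnes (suc n) w) h)
      ≡⟨ Σ-upTo-suc m _ ⟩
    Σ (map (false ∷_) (withOnes n 0)) h ∙ Σ (upTo m) (λ w → Σ (withOnes (suc n) (suc w)) h)
      ≈⟨ ∙-cong (reflexive (Σ-map (false ∷_) (withOnes n 0) h))
                (Σ-cong (upTo m) (λ w → Σ-1∷-++-0∷ (withOnes n w) (withOnes n (suc w)) h)) ⟩
    B 0 ∙ Σ (upTo m) (λ w → A w ∙ B (suc w))    ≈⟨ ∙-congˡ (Σ-∙ (upTo m) A (B ∘ suc)) ⟩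
    B 0 ∙ (Σ (upTo m) A ∙ Σ (upTo m) (B ∘ suc)) ≈⟨ x∙yz≈y∙xz _ _ _ ⟩
    Σ (upTo m) A ∙ (B 0 ∙ Σ (upTo m) (B ∘ suc)) ≡⟨ P.cong (Σ (upTo m) A ∙_) (Σ-upTo-suc m B) ⟨
    Σ (upTo m) A ∙ Σ (upTo (suc m)) B
      ≈⟨ ∙-cong (Σ-byWeight n m n<m (h ∘ (true ∷_)))
                (Σ-byWeight n (suc m) (ℕₚ.m≤n⇒m≤1+n n<m) (h ∘ (false ∷_))) ⟩
    Σ (allTuples n) (h ∘ (true ∷_)) ∙ Σ (allTuples n) (h ∘ (false ∷_)) ≈⟨ Σ-cube-suc n h ⟨
    Σ (allTuples (suc n)) h ∎
    where
    A B : ℕ → Carrier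
    A w = Σ (withOnes n w) (h ∘ (true ∷_))
    B w = Σ (withOnes n w) (h ∘ (false ∷_))

  Σ-T : ∀ s (h : Vec Bool s → Carrier) → Σ (allFin (N s)) (h ∘ T s) ≈ Σ (allTuples s) h
  Σ-T s h = begin
    Σ (allFin (N s)) (h ∘ T s)                      ≡⟨ Σ-allFin-lookup (Tlist s) h ⟩
    Σ (Tlist s) h                                   ≈⟨ Σ-concatMap (withOnes s) (upTo (suc s)) h ⟩
    Σ (upTo (suc s)) (λ w → Σ (withOnes s w) h)     ≈⟨ Σ-byWeight s (suc s) (ℕₚ.n<1+n s) h ⟩
    Σ (allTuples s) h                               ∎

T-enumerates-once : ∀ s (v : Vec Bool s) → count (allFin (N s)) (λ i → eqVec v (T s i)) ≡ 1
T-enumerates-once s v =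
  P.trans (Σ-T s (λ e → when (eqVec v e) 1)) (Σ-cube-δ s v (λ _ → 1))
  where
  open ListSum ℕₚ.+-0-commutativeMonoid using (when)
  open CubeSum ℕₚ.+-0-commutativeMonoid using (Σ-T; Σ-cube-δ)

HasChar2 : ∀ {c ℓ} → CommutativeRing c ℓ → Set ℓ
HasChar2 R = 1# + 1# ≈ 0#
  where open CommutativeRing R

module Characteristic {c ℓ} (F : Field c ℓ) {n : ℕ} (H : HasCardinality F n) where
  open Field F
  open HasCardinality H
  open import Relation.Binary.Reasoning.Setoid setoid
  open import Algebra.Properties.CommutativeMonoid.Sum +-commutativeMonoid
    using (sum; sum-permute; sum-cong-≋; ∑-distrib-+; sum-replicate)
  open import Algebra.Properties.Semiring.Mult semiring
    using (idem-×-homo-*) renaming (_×_ to _·1×_)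

  index : Carrier → Fin n
  index x = proj₁ (enum-surj x)

  index-spec : ∀ x → enum (index x) ≈ x
  index-spec x = proj₂ (enum-surj x)

  index-cong : ∀ {x y} → x ≈ y → index x ≡ index y
  index-cong {x} {y} x≈y = enum-inj _ _ (trans (index-spec x) (trans x≈y (sym (index-spec y))))

  shift : Carrier → Fin n → Fin n
  shift a i = index (enum i + a)

  shift-inverse : ∀ a b → a + b ≈ 0# → ∀ i → shift b (shift a i) ≡ i
  shift-inverse a b a+b≈0 i = enum-inj _ _ (trans (index-spec _) (begin
    enum (shift a i) + b  ≈⟨ +-congʳ (index-spec _) ⟩
    (enum i + a) + b      ≈⟨ +-assoc _ _ _ ⟩
    enum i + (a + b)      ≈⟨ +-congˡ a+b≈0 ⟩
    enum i + 0#           ≈⟨ +-identityʳ _ ⟩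
    enum i                ∎))

  -- The sum S of all elements is invariant under x ↦ x + 1, so S = S + n·1.
  card·1≈0 : n ·1× 1# ≈ 0#
  card·1≈0 = begin
    n ·1× 1#                ≈⟨ sym (+-identityˡ _) ⟩
    0# + n ·1× 1#           ≈⟨ +-congʳ (sym (-‿inverseˡ S)) ⟩
    (- S + S) + n ·1× 1#    ≈⟨ +-assoc _ _ _ ⟩
    - S + (S + n ·1× 1#)    ≈⟨ +-congˡ (sym S≈S+n) ⟩
    - S + S                 ≈⟨ -‿inverseˡ S ⟩
    0#                      ∎
    where
    S : Carrier
    S = sum {n} enum
    S≈S+n : S ≈ S + n ·1× 1#
    S≈S+n = begin
      S                                    ≈⟨ sum-permute {n} enum (permutation (shift 1#) (shift (- 1#))
                                                (shift-inverse (- 1#) 1# (-‿inverseˡ 1#))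
                                                (shift-inverse 1# (- 1#) (-‿inverseʳ 1#))) ⟩
      sum {n} (λ i → enum (shift 1# i))    ≈⟨ sum-cong-≋ {n} (λ i → index-spec _) ⟩
      sum {n} (λ i → enum i + 1#)          ≈⟨ ∑-distrib-+ {n} enum (λ _ → 1#) ⟩
      S + sum {n} (λ _ → 1#)               ≈⟨ +-congˡ (sum-replicate n) ⟩
      S + n ·1× 1#                         ∎

  2^j·1≉0 : ∀ j → ¬ (1# + 1# ≈ 0#) → ¬ ((2 ^ j) ·1× 1# ≈ 0#)
  2^j·1≉0 zero    _   1≈0 = 0≉1 (sym (trans (sym (+-identityʳ 1#)) 1≈0))
  2^j·1≉0 (suc j) 2≉0 2^[1+j]≈0 with inverse (1# + 1#) 2≉0
  ... | y , 2y≈1 = 2^j·1≉0 j 2≉0 (begin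
    X                         ≈⟨ *-identityˡ X ⟨
    1# * X                    ≈⟨ *-congʳ (trans (sym 2y≈1) (*-comm _ _)) ⟩
    (y * (1# + 1#)) * X       ≈⟨ *-assoc _ _ _ ⟩
    y * ((1# + 1#) * X)       ≈⟨ *-congˡ (*-congʳ (+-congˡ (sym (+-identityʳ 1#)))) ⟩
    y * ((2 ·1× 1#) * X)      ≈⟨ *-congˡ (idem-×-homo-* 2 (2 ^ j) (*-identityˡ 1#)) ⟩
    y * ((2 ^ suc j) ·1× 1#)  ≈⟨ *-congˡ 2^[1+j]≈0 ⟩
    y * 0#                    ≈⟨ zeroʳ y ⟩
    0#                        ∎)
    where
    X : Carrier
    X = (2 ^ j) ·1× 1#

  char2 : ∀ m → n ≡ 2 ^ m → HasChar2 commutativeRing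
  char2 m n≡2^m with index (1# + 1#) ≟ index 0#
  ... | yes eq = trans (sym (index-spec _)) (trans (reflexive (P.cong enum eq)) (index-spec 0#))
  ... | no  ne = ⊥-elim (2^j·1≉0 m (λ 2≈0 → ne (index-cong 2≈0))
                   (P.subst (λ k → k ·1× 1# ≈ 0#) n≡2^m card·1≈0))

module RingSum {c ℓ} (R : CommutativeRing c ℓ) where
  open CommutativeRing R
  open ListSum +-commutativeMonoid public
  open CubeSum +-commutativeMonoid public
  module Π = ListSum *-commutativeMonoid

  [_] : Bool → Carrier
  [ b ] = when b 1#

  Σ-*ˡ : ∀ {a} {A : Set a} (L : List A) y f → Σ L (λ x → y * f x) ≈ y * Σ L f
  Σ-*ˡ []      y f = sym (zeroʳ y)
  Σ-*ˡ (x ∷ L) y f = trans (+-congˡ (Σ-*ˡ L y f)) (sym (distribˡ y _ _))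

  Σ-*ʳ : ∀ {a} {A : Set a} (L : List A) y f → Σ L (λ x → f x * y) ≈ Σ L f * y
  Σ-*ʳ []      y f = sym (zeroˡ y)
  Σ-*ʳ (x ∷ L) y f = trans (+-congˡ (Σ-*ʳ L y f)) (sym (distribʳ y _ _))

  when-+ : ∀ b p q → when b (p + q) ≈ when b p + when b q
  when-+ true  p q = refl
  when-+ false p q = sym (+-identityˡ 0#)

  when-* : ∀ a b p q → when (a ∧ b) (p * q) ≈ when a p * when b q
  when-* true  true  p q = refl
  when-* true  false p q = sym (zeroʳ p)
  when-* false b     p q = sym (zeroˡ _)

  when≈*[] : ∀ b y → when b y ≈ y * [ b ]
  when≈*[] true  y = sym (*-identityʳ y)
  when≈*[] false y = sym (zeroʳ y)

  []-∧ : ∀ a b → [ a ] * [ b ] ≈ [ a ∧ b ]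
  []-∧ true  b = *-identityˡ _
  []-∧ false b = zeroˡ _

  -- The value at a point with j-th coordinate x₀ of u_j^{e₀}, and of θ^{r₀}(u_j).
  uFactor θFactor : Bool → Bool → Carrier
  uFactor e₀ x₀ = if e₀ then [ x₀ ] else 1#
  θFactor r₀ x₀ = [ eqB x₀ (not r₀) ]

  Π-≼ : ∀ n (e x : Vec Bool n) →
        Π.Σ (allFin n) (λ j → uFactor (lookup e j) (lookup x j)) ≈ [ e ≼ x ]
  Π-≼ zero    []       []       = refl
  Π-≼ (suc n) (e₀ ∷ e) (x₀ ∷ x) =
    trans (reflexive (Π.Σ-allFin-suc {n} (λ j → uFactor (lookup (e₀ ∷ e) j) (lookup (x₀ ∷ x) j))))
          (trans (*-congˡ (Π-≼ n e x)) (head e₀ x₀))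
    where
    head : ∀ e₀ x₀ → uFactor e₀ x₀ * [ e ≼ x ] ≈ [ (e₀ ≤ᵇ x₀) ∧ (e ≼ x) ]
    head true  true  = *-identityˡ _
    head true  false = zeroˡ _
    head false x₀    = *-identityˡ _

  Π-≡∁ : ∀ n (r x : Vec Bool n) →
         Π.Σ (allFin n) (λ j → θFactor (lookup r j) (lookup x j)) ≈ [ eqVec x (∁ r) ]
  Π-≡∁ zero    []       []       = refl
  Π-≡∁ (suc n) (r₀ ∷ r) (x₀ ∷ x) =
    trans (reflexive (Π.Σ-allFin-suc {n} (λ j → θFactor (lookup (r₀ ∷ r) j) (lookup (x₀ ∷ x) j))))
          (trans (*-congˡ (Π-≡∁ n r x)) ([]-∧ _ _))

-- Möbius inversion on the Boolean lattice in characteristic 2: the interval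
-- [d, e] = {x | d ≼ x ≼ e} has 2^(|e|-|d|) elements when d ≼ e, an odd number
-- exactly when d = e.
module Char2 {c ℓ} (R : CommutativeRing c ℓ) (char2 : HasChar2 R) where
  open CommutativeRing R
  open RingSum R
  open import Relation.Binary.Reasoning.Setoid setoid

  y+y≈0 : ∀ y → y + y ≈ 0#
  y+y≈0 y = begin
    y + y              ≈⟨ +-cong (*-identityˡ y) (*-identityˡ y) ⟨
    1# * y + 1# * y    ≈⟨ distribʳ y 1# 1# ⟨
    (1# + 1#) * y      ≈⟨ *-congʳ char2 ⟩
    0# * y             ≈⟨ zeroˡ y ⟩
    0#                 ∎

  Σ-failed : ∀ n (d : Vec Bool n) y → Σ (allTuples n) (λ x → when ((d ≼ x) ∧ false) y) ≈ 0#
  Σ-failed n d y = Σ-zero (allTuples n) _ (λ x → reflexive (P.cong (λ b → when b y) (∧-zeroʳ (d ≼ x))))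

  -- Split on the first coordinate x₀: if d₀ = e₀ only one value of x₀ is
  -- allowed, if (d₀, e₀) = (0, 1) both are and the two halves cancel, and if
  -- (d₀, e₀) = (1, 0) the interval is empty.
  Σ-interval : ∀ n (d e : Vec Bool n) y →
               Σ (allTuples n) (λ x → when ((d ≼ x) ∧ (x ≼ e)) y) ≈ when (eqVec d e) y
  Σ-interval zero    []         []         y = +-identityʳ y
  Σ-interval (suc n) (true ∷ d) (true ∷ e) y = begin
    _                             ≈⟨ Σ-cube-suc n _ ⟩
    _                             ≈⟨ +-cong (Σ-interval n d e y) (Σ-ε (allTuples n)) ⟩
    when (eqVec d e) y + 0#       ≈⟨ +-identityʳ _ ⟩
    when (eqVec d e) y            ∎
  Σ-interval (suc n) (false ∷ d) (false ∷ e) y = begin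
    _                             ≈⟨ Σ-cube-suc n _ ⟩
    _                             ≈⟨ +-cong (Σ-failed n d y) (Σ-interval n d e y) ⟩
    0# + when (eqVec d e) y       ≈⟨ +-identityˡ _ ⟩
    when (eqVec d e) y            ∎
  Σ-interval (suc n) (false ∷ d) (true ∷ e)  y = begin
    _                             ≈⟨ Σ-cube-suc n _ ⟩
    _                             ≈⟨ +-cong (Σ-interval n d e y) (Σ-interval n d e y) ⟩
    when (eqVec d e) y + when (eqVec d e) y ≈⟨ y+y≈0 _ ⟩
    0#                            ∎
  Σ-interval (suc n) (true ∷ d)  (false ∷ e) y = begin
    _                             ≈⟨ Σ-cube-suc n _ ⟩
    _                             ≈⟨ +-cong (Σ-failed n d y) (Σ-ε (allTuples n)) ⟩
    0# + 0#                       ≈⟨ +-identityˡ _ ⟩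
    0#                            ∎


module Evaluation {c ℓ} (F : Field c ℓ) (char2 : HasChar2 (Field.commutativeRing F)) (s : ℕ) where
  open Field F
  open RingSum commutativeRing
  open Char2 commutativeRing char2
  open QuotientRing F s
  open import Relation.Binary.Reasoning.Setoid setoid

  cube : List (Vec Bool s)
  cube = allTuples s

  -- p(x) = Σ_{e ≼ x} p_e, the value of p at u = x.
  eval : Vec Bool s → R → Carrier
  eval x p = Σ cube (λ e → when (e ≼ x) (p e))

  eval-cong : ∀ x {p q} → p ≈R q → eval x p ≈ eval x q
  eval-cong x p≈q = Σ-cong cube (λ e → when-cong (e ≼ x) (p≈q e))

  eval-+ : ∀ x p q → eval x (p +R q) ≈ eval x p + eval x q
  eval-+ x p q = trans (Σ-cong cube (λ e → when-+ (e ≼ x) (p e) (q e))) (Σ-∙ cube _ _)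

  eval-0 : ∀ x → eval x 0R ≈ 0#
  eval-0 x = Σ-zero cube _ (λ e → reflexive (when-ε (e ≼ x)))

  eval-monomial : ∀ x c y → Σ cube (λ e → when (e ≼ x) (when (eqVec c e) y)) ≈ when (c ≼ x) y
  eval-monomial x c y =
    trans (Σ-cong cube (λ e → reflexive (swap e))) (Σ-cube-δ s c (λ _ → when (c ≼ x) y))
    where
    swap : ∀ e → when (e ≼ x) (when (eqVec c e) y) ≡ when (eqVec c e) (when (c ≼ x) y)
    swap e with eqVec c e in c≟e
    ... | true rewrite eqVec-sound c e c≟e = P.refl
    ... | false = when-ε (e ≼ x)

  eval-ι : ∀ x a → eval x (ι a) ≈ a
  eval-ι x a = begin
    eval x (ι a)
      ≈⟨ Σ-cong cube (λ e → reflexive (P.cong (λ b → when (e ≼ x) (when b a)) (isZero-eqVec e))) ⟩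
    Σ cube (λ e → when (e ≼ x) (when (eqVec (tabulate (λ _ → false)) e) a))
      ≈⟨ eval-monomial x (tabulate (λ _ → false)) a ⟩
    when (tabulate (λ _ → false) ≼ x) a
      ≡⟨ P.cong (λ b → when b a) (zero-≼ x) ⟩
    a ∎

  eval-u : ∀ x j → eval x (u j) ≈ [ lookup x j ]
  eval-u x j = begin
    eval x (u j)
      ≈⟨ Σ-cong cube (λ e → reflexive (P.cong (λ b → when (e ≼ x) [ b ]) (eqVec-sym e (unitVec j)))) ⟩
    Σ cube (λ e → when (e ≼ x) [ eqVec (unitVec j) e ])
      ≈⟨ eval-monomial x (unitVec j) 1# ⟩
    [ unitVec j ≼ x ]
      ≡⟨ P.cong [_] (unitVec-≼ j x) ⟩
    [ lookup x j ] ∎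

  coeff-*R : ∀ p q e →
             (p *R q) e ≈ Σ cube (λ a → Σ cube (λ b → when (eqVec (zipWith _∨_ a b) e) (p a * q b)))
  coeff-*R p q e = begin
    sumF (concatMap (λ a → map (term a) cube) cube)
      ≡⟨ P.cong (foldr _+_ 0#) (Listₚ.map-id (concatMap (λ a → map (term a) cube) cube)) ⟨
    Σ (concatMap (λ a → map (term a) cube) cube) (λ z → z)
      ≈⟨ Σ-concatMap (λ a → map (term a) cube) cube (λ z → z) ⟩
    Σ cube (λ a → Σ (map (term a) cube) (λ z → z))
      ≈⟨ Σ-cong cube (λ a → reflexive (Σ-map (term a) cube (λ z → z))) ⟩
    Σ cube (λ a → Σ cube (term a)) ∎
    where
    term : Vec Bool s → Vec Bool s → Carrier
    term a b = when (eqVec (zipWith _∨_ a b) e) (p a * q b)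

  -- Evaluation is multiplicative, because a ∨ b ≼ x iff a ≼ x and b ≼ x.
  eval-* : ∀ x p q → eval x (p *R q) ≈ eval x p * eval x q
  eval-* x p q = begin
    eval x (p *R q)
      ≈⟨ Σ-cong cube (λ e → when-cong (e ≼ x) (coeff-*R p q e)) ⟩
    Σ cube (λ e → when (e ≼ x) (Σ cube (λ a → Σ cube (λ b → term a b e))))
      ≈⟨ Σ-cong cube (λ e → trans (Σ-when (e ≼ x) cube _) (Σ-cong cube (λ a → Σ-when (e ≼ x) cube _))) ⟩
    Σ cube (λ e → Σ cube (λ a → Σ cube (λ b → when (e ≼ x) (term a b e))))
      ≈⟨ trans (Σ-swap cube cube _) (Σ-cong cube (λ a → Σ-swap cube cube _)) ⟩
    Σ cube (λ a → Σ cube (λ b → Σ cube (λ e → when (e ≼ x) (term a b e))))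
      ≈⟨ Σ-cong cube (λ a → Σ-cong cube (λ b → eval-monomial x (zipWith _∨_ a b) (p a * q b))) ⟩
    Σ cube (λ a → Σ cube (λ b → when (zipWith _∨_ a b ≼ x) (p a * q b)))
      ≈⟨ Σ-cong cube (λ a → Σ-cong cube (λ b → split a b)) ⟩
    Σ cube (λ a → Σ cube (λ b → when (a ≼ x) (p a) * when (b ≼ x) (q b)))
      ≈⟨ Σ-cong cube (λ a → Σ-*ˡ cube _ _) ⟩
    Σ cube (λ a → when (a ≼ x) (p a) * eval x q)
      ≈⟨ Σ-*ʳ cube _ _ ⟩
    eval x p * eval x q ∎
    where
    term : Vec Bool s → Vec Bool s → Vec Bool s → Carrier
    term a b e = when (eqVec (zipWith _∨_ a b) e) (p a * q b)
    split : ∀ a b → when (zipWith _∨_ a b ≼ x) (p a * q b) ≈ when (a ≼ x) (p a) * when (b ≼ x) (q b)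
    split a b = trans (reflexive (P.cong (λ t → when t (p a * q b)) (∨-≼ a b x))) (when-* _ _ _ _)

  eval-Σ : ∀ {a} {A : Set a} x (K : List A) (f : A → R) →
           eval x (foldr _+R_ 0R (map f K)) ≈ Σ K (λ i → eval x (f i))
  eval-Σ x []      f = eval-0 x
  eval-Σ x (i ∷ K) f = trans (eval-+ x _ _) (+-congˡ (eval-Σ x K f))

  eval-Π : ∀ {a} {A : Set a} x (K : List A) (f : A → R) →
           eval x (foldr _*R_ 1R (map f K)) ≈ Π.Σ K (λ i → eval x (f i))
  eval-Π x []      f = eval-ι x 1#
  eval-Π x (i ∷ K) f = trans (eval-* x _ _) (*-congˡ (eval-Π x K f))

  eval-U : ∀ x e → eval x (Umon e) ≈ [ e ≼ x ]
  eval-U x e = trans (eval-Π x (allFin s) _) (trans (Π.Σ-cong (allFin s) factor) (Π-≼ s e x))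
    where
    factor : ∀ j → eval x (if lookup e j then u j else 1R) ≈ uFactor (lookup e j) (lookup x j)
    factor j with lookup e j
    ... | true  = eval-u x j
    ... | false = eval-ι x 1#

  -- θ^r(u_j)(x) = [x_j = not r]; for r = 1 this is x_j + 1 = [x_j = 0] in characteristic 2.
  eval-θ : ∀ x r j → eval x (θpow r j) ≈ θFactor r (lookup x j)
  eval-θ x false j = trans (eval-u x j) (same (lookup x j))
    where
    same : ∀ b → [ b ] ≈ [ eqB b true ]
    same true  = refl
    same false = refl
  eval-θ x true j = trans (eval-+ x _ _) (trans (+-cong (eval-u x j) (eval-ι x 1#)) (flip (lookup x j)))
    where
    flip : ∀ b → [ b ] + 1# ≈ [ eqB b false ]
    flip true  = char2
    flip false = +-identityˡ 1#

  -- I_r(x) = [x = ∁r]: the idempotent I_r is the indicator of the point ∁r.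
  eval-I : ∀ x r → eval x (Iidem r) ≈ [ eqVec x (∁ r) ]
  eval-I x r = trans (eval-Π x (allFin s) _)
                     (trans (Π.Σ-cong (allFin s) (λ j → eval-θ x (lookup r j) j)) (Π-≡∁ s r x))

  -- Möbius inversion: p_e = Σ_{x ≼ e} p(x), the signs being invisible in
  -- characteristic 2.
  möbius : ∀ p e → Σ cube (λ x → when (x ≼ e) (eval x p)) ≈ p e
  möbius p e = begin
    Σ cube (λ x → when (x ≼ e) (eval x p))
      ≈⟨ Σ-cong cube (λ x → Σ-when (x ≼ e) cube _) ⟩
    Σ cube (λ x → Σ cube (λ d → when (x ≼ e) (when (d ≼ x) (p d))))
      ≈⟨ Σ-cong cube (λ x → Σ-cong cube (λ d → reflexive (when-when (x ≼ e) (d ≼ x) (p d)))) ⟩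
    Σ cube (λ x → Σ cube (λ d → when ((d ≼ x) ∧ (x ≼ e)) (p d)))
      ≈⟨ Σ-swap cube cube _ ⟩
    Σ cube (λ d → Σ cube (λ x → when ((d ≼ x) ∧ (x ≼ e)) (p d)))
      ≈⟨ Σ-cong cube (λ d → Σ-interval s d e (p d)) ⟩
    Σ cube (λ d → when (eqVec d e) (p d))
      ≈⟨ Σ-cong cube (λ d → reflexive (P.cong (λ b → when b (p d)) (eqVec-sym d e))) ⟩
    Σ cube (λ d → when (eqVec e d) (p d))
      ≈⟨ Σ-cube-δ s e p ⟩
    p e ∎

  eval-injective : ∀ {p q} → (∀ x → eval x p ≈ eval x q) → p ≈R q
  eval-injective {p} {q} p≡q e =
    trans (sym (möbius p e)) (trans (Σ-cong cube (λ x → when-cong (x ≼ e) (p≡q x))) (möbius q e))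

module GrayMap {c ℓ} (F : Field c ℓ) (char2 : HasChar2 (Field.commutativeRing F)) (s : ℕ) where
  open Field F
  open RingSum commutativeRing
  open QuotientRing F s
  open Evaluation F char2 s
  open import Relation.Binary.Reasoning.Setoid setoid

  indices : List (Fin (N s))
  indices = allFin (N s)

  eval-combU : ∀ x b → eval x (combU b) ≈ Σ indices (λ j → b j * [ T s j ≼ x ])
  eval-combU x b = trans (eval-Σ x indices _)
    (Σ-cong indices (λ j → trans (eval-* x _ _) (*-cong (eval-ι x (b j)) (eval-U x (T s j)))))

  eval-combI : ∀ x a → eval x (combI a) ≈ Σ indices (λ i → a i * [ eqVec x (∁ (T s i)) ])
  eval-combI x a = trans (eval-Σ x indices _)
    (Σ-cong indices (λ i → trans (eval-* x _ _) (*-cong (eval-ι x (a i)) (eval-I x (T s i)))))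

  -- Σ_i [T_i · t = 0] [x = ∁T_i] = [t ≼ x]: only the index with T_i = ∁x
  -- contributes, and ∁x is disjoint from t iff t ≼ x.
  Σ-disjoint : ∀ x t →
    Σ indices (λ i → [ isZero (T s i · t) ] * [ eqVec x (∁ (T s i)) ]) ≈ [ t ≼ x ]
  Σ-disjoint x t = begin
    Σ indices (H ∘ T s)
      ≈⟨ Σ-T s H ⟩
    Σ cube H
      ≈⟨ Σ-cong cube (λ v → trans ([]-∧ _ _) (reflexive (regroup v))) ⟩
    Σ cube (λ v → when (eqVec (∁ x) v) [ isZero (v · t) ])
      ≈⟨ Σ-cube-δ s (∁ x) _ ⟩
    [ isZero (∁ x · t) ]
      ≡⟨ P.cong [_] (P.trans (isZero-·-≼∁ (∁ x) t) (P.cong (t ≼_) (∁-involutive x))) ⟩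
    [ t ≼ x ] ∎
    where
    H : Vec Bool s → Carrier
    H v = [ isZero (v · t) ] * [ eqVec x (∁ v) ]
    regroup : ∀ v → [ isZero (v · t) ∧ eqVec x (∁ v) ] ≡ when (eqVec (∁ x) v) [ isZero (v · t) ]
    regroup v = P.trans (P.cong (λ b → [ isZero (v · t) ∧ b ]) (eqVec-∁ʳ x v))
                        (P.sym (when-when (eqVec (∁ x) v) (isZero (v · t)) 1#))

  -- The claimed Gray image represents α: both sides agree at every point.
  existence : ∀ b → IdemCoeffs (combU b) (grayFormula b)
  existence b = eval-injective λ x → begin
    eval x (combI (grayFormula b))
      ≈⟨ eval-combI x (grayFormula b) ⟩
    Σ indices (λ i → grayFormula b i * S x i)
      ≈⟨ Σ-cong indices (λ i → sym (Σ-*ʳ indices (S x i) _)) ⟩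
    Σ indices (λ i → Σ indices (λ j → when (isZero (T s i · T s j)) (b j) * S x i))
      ≈⟨ Σ-swap indices indices _ ⟩
    Σ indices (λ j → Σ indices (λ i → when (isZero (T s i · T s j)) (b j) * S x i))
      ≈⟨ Σ-cong indices (column x) ⟩
    Σ indices (λ j → b j * [ T s j ≼ x ])
      ≈⟨ eval-combU x b ⟨
    eval x (combU b) ∎
    where
    S : Vec Bool s → Fin (N s) → Carrier
    S x i = [ eqVec x (∁ (T s i)) ]
    column : ∀ x j → Σ indices (λ i → when (isZero (T s i · T s j)) (b j) * S x i) ≈ b j * [ T s j ≼ x ]
    column x j = begin
      Σ indices (λ i → when (isZero (T s i · T s j)) (b j) * S x i)
        ≈⟨ Σ-cong indices (λ i → trans (*-congʳ (when≈*[] _ (b j))) (*-assoc _ _ _)) ⟩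
      Σ indices (λ i → b j * ([ isZero (T s i · T s j) ] * S x i))
        ≈⟨ Σ-*ˡ indices (b j) _ ⟩
      b j * Σ indices (λ i → [ isZero (T s i · T s j) ] * S x i)
        ≈⟨ *-congˡ (Σ-disjoint x (T s j)) ⟩
      b j * [ T s j ≼ x ] ∎

  -- Any representation of α has the claimed coefficients: evaluating it at
  -- ∁T_i extracts its i-th coefficient.
  uniqueness : ∀ b a → IdemCoeffs (combU b) a → ∀ i → a i ≈ grayFormula b i
  uniqueness b a α≈ i = begin
    a i
      ≈⟨ Σ-when-unique (λ j → eqVec (T s i) (T s j)) a indices (∈-allFin i)
           (eqVec-refl (T s i)) (T-enumerates-once s (T s i)) ⟨
    Σ indices (λ j → when (eqVec (T s i) (T s j)) (a j))
      ≈⟨ Σ-cong indices (λ j → trans (when≈*[] _ (a j))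
           (reflexive (P.cong (λ t → a j * [ t ]) (P.sym (eqVec-∁∁ (T s i) (T s j)))))) ⟩
    Σ indices (λ j → a j * [ eqVec x (∁ (T s j)) ])
      ≈⟨ eval-combI x a ⟨
    eval x (combI a)
      ≈⟨ eval-cong x α≈ ⟩
    eval x (combU b)
      ≈⟨ eval-combU x b ⟩
    Σ indices (λ j → b j * [ T s j ≼ x ])
      ≈⟨ Σ-cong indices (λ j → trans
           (reflexive (P.cong (λ t → b j * [ t ]) (P.sym (isZero-·-≼∁ (T s i) (T s j)))))
           (sym (when≈*[] _ (b j)))) ⟩
    grayFormula b i ∎
    where
    x : Vec Bool s
    x = ∁ (T s i)

open import Data.Nat using (_*_)

proposition1 : ∀ {c ℓ} (F : Field c ℓ) (k s : ℕ) → k ≥ 1 → s ≥ 1 →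
    HasCardinality F (4 ^ (2 * k)) →
    (b : Fin (N s) → Field.Carrier F) →
      QuotientRing.IdemCoeffs F s (QuotientRing.combU F s b) (QuotientRing.grayFormula F s b)
      × (∀ (a : Fin (N s) → Field.Carrier F) →
           QuotientRing.IdemCoeffs F s (QuotientRing.combU F s b) a →
           ∀ i → Field._≈_ F (a i) (QuotientRing.grayFormula F s b i))
proposition1 F k s _ _ card b = existence b , uniqueness b
  where
  -- 4^(2k) = 2^(4k), so F has characteristic 2.
  open GrayMap F (Characteristic.char2 F card (2 * (2 * k)) (ℕₚ.^-*-assoc 2 2 (2 * k))) s
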